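{- Let $G$ be a disconnected graph with connected components $G_1,\dots,G_n$, and for each $i$ let $w_i$ be a square-free word representing $G_i$. Suppose some component $G_j$ is not a complete graph, let $k$ be the representation number of $G_j$, and suppose $w_j$ is a $k$-uniform word representing $G_j$. Then the word $$w = w_1\cdots w_{j-1}w_jw_{j+1}\cdots w_n\,\sigma(w_j)\,\sigma(w_n)\cdots\sigma(w_{j+1})\,\sigma(w_{j-1})\cdots\sigma(w_1)$$ represents $G$.
   Context: A word $w$ over the alphabet $V$ represents the simple graph $G=(V,E)$ if every letter of $V$ occurs in $w$ and, for all distinct $x,y\in V$, $x$ and $y$ alternate in $w$ (deleting all other letters leaves $xyxy\cdots$ or $yxyx\cdots$) if and only if $xy\in E$. A word is $k$-uniform if every letter occurs exactly $k$ times; the representation number of a word-representable graph is the least $k$ such that some $k$-uniform word represents it. For a word $u$, $\sigma(u)$ (the final permutation) is obtained from $u$ by deleting all but the rightmost occurrence of each letter. A square is a factor $XX$ with $X$ non-empty; a word is square-free if it contains no square. -}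

module Defs where

open import Data.Nat using (ℕ; _≟_)
open import Data.Fin as Fin using (Fin)
open import Data.List using (List; []; _∷_; _++_; concat; map; filter; reverse; length)
open import Data.List.Relation.Unary.Unique.Propositional using (Unique)
open import Data.List.Membership.Propositional using (_∈_)
open import Data.List.Membership.DecPropositional _≟_ using (_∈?_)
open import Data.List.Relation.Unary.Any using (Any)
open import Data.Vec.Functional using ()
open import Data.Product using (Σ; ∃; ∃-syntax; _×_; _,_)
open import Data.Sum using (_⊎_)
open import Data.Empty using (⊥)
open import Relation.Nullary using (¬_; ¬?; does)
open import Relation.Nullary.Decidable using (_⊎-dec_)
open import Relation.Binary.PropositionalEquality using (_≡_; _≢_)
open import Function.Bundles using (_⇔_)
open import Data.Bool using (if_then_else_)

Letter : Set
Letter = ℕ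

Word : Set
Word = List Letter

record Graph : Set₁ where
  field
    V       : List Letter
    V-uniq  : Unique V
    Adj     : Letter → Letter → Set
    Adj-sym : ∀ {x y} → Adj x y → Adj y x
    Adj-irr : ∀ {x} → ¬ Adj x x
    Adj-V   : ∀ {x y} → Adj x y → (x ∈ V) × (y ∈ V)
open Graph public

restrict : Letter → Letter → Word → Word
restrict x y = filter (λ z → (z ≟ x) ⊎-dec (z ≟ y))

NoAdjRepeat : Word → Set
NoAdjRepeat []           = Data.Unit.⊤ where import Data.Unit
NoAdjRepeat (a ∷ [])     = Data.Unit.⊤ where import Data.Unit
NoAdjRepeat (a ∷ b ∷ u)  = (a ≢ b) × NoAdjRepeat (b ∷ u)

-- x and y alternate in w: deleting all other letters leaves xyxy... or yxyx...
Alternate : Letter → Letter → Word → Set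
Alternate x y w = NoAdjRepeat (restrict x y w)

Represents : Word → Graph → Set
Represents w G =
  (∀ x → (x ∈ w) ⇔ (x ∈ V G)) ×
  (∀ x y → x ∈ V G → y ∈ V G → x ≢ y → (Alternate x y w ⇔ Adj G x y))

Uniform : ℕ → Word → Set
Uniform k w = ∀ x → x ∈ w → length (filter (_≟ x) w) ≡ k

RepNumber : Graph → ℕ → Set
RepNumber G k =
  (∃[ w ] (Uniform k w × Represents w G)) ×
  (∀ k′ w → Uniform k′ w → Represents w G → k Data.Nat.≤ k′)
  where import Data.Nat

σ : Word → Word
σ []      = []
σ (x ∷ u) = if does (x ∈? u) then σ u else x ∷ σ u

SquareFree : Word → Set
SquareFree w = ¬ (∃[ u ] ∃[ X ] ∃[ v ] ((X ≢ []) × (w ≡ u ++ X ++ X ++ v)))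

Complete : Graph → Set
Complete G = ∀ x y → x ∈ V G → y ∈ V G → x ≢ y → Adj G x y

data Reach (G : Graph) : Letter → Letter → Set where
  here : ∀ {x} → Reach G x x
  step : ∀ {x y z} → Adj G x y → Reach G y z → Reach G x z

Connected : Graph → Set
Connected G = (V G ≢ []) × (∀ x y → x ∈ V G → y ∈ V G → Reach G x y)

ComponentsOf : Graph → (n : ℕ) → (Fin n → Graph) → Set
ComponentsOf G n Gs =
  (∀ i → Connected (Gs i)) ×
  (∀ x → (x ∈ V G) ⇔ (∃[ i ] (x ∈ V (Gs i)))) ×
  (∀ i i′ x → x ∈ V (Gs i) → x ∈ V (Gs i′) → i ≡ i′) ×
  (∀ i x y → x ∈ V (Gs i) → y ∈ V (Gs i) → (Adj G x y ⇔ Adj (Gs i) x y)) ×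
  (∀ x y → Adj G x y → ∃[ i ] ((x ∈ V (Gs i)) × (y ∈ V (Gs i))))

-- The word w₁⋯wₙ σ(w_j) σ(w_n)⋯σ(w_{j+1}) σ(w_{j-1})⋯σ(w₁).
glue : (n : ℕ) → (Fin n → Word) → Fin n → Word
glue n ws j =
  concat (map ws (Data.List.allFin n)) ++
  σ (ws j) ++
  concat (map (λ i → σ (ws i))
    (filter (λ i → ¬? (i Fin.≟ j)) (reverse (Data.List.allFin n))))
  where import Data.List

-- Restrict the glued word to two letters x ≠ y. If both lie in one component a, every
-- block except those of component a vanishes, leaving r ++ σ r for r the restriction of
-- w_a; as σ r consists of the last two letters of r, this alternates iff r does.
-- If x ∈ G_a and y ∈ G_b with a ≠ b, every surviving block is a power of x or of y. When
-- a or b is j, the block w_j alone repeats its letter: a 1-uniform word represents a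
-- complete graph, so every letter occurs at least twice in w_j. Otherwise the middle
-- block σ(w_j) vanishes and the component coming later in w₁⋯wₙ has its two blocks
-- adjacent at the turn, repeating its letter.

module Submission where

open import Defs
open import Data.Nat using (ℕ; suc; _≤_; _≥_; s≤s; z≤n; _≟_)
open import Data.Nat.Properties using (+-mono-≤; suc-injective)
open import Data.Bool using (if_then_else_)
open import Data.List using (List; []; _∷_; _++_; [_]; concat; map; filter; reverse; length; allFin)
open import Data.List.Properties
  using (++-assoc; ++-identityʳ; filter-++; filter-≐; filter-none; filter-accept; filter-reject; filter-some;
         unfold-reverse; map-++; concat-++; length-++)
open import Data.List.Membership.Propositional using (_∈_; _∉_)
open import Data.List.Membership.Propositional.Properties using (∉[]; ∈-++⁺ˡ; ∈-++⁺ʳ; ∈-concat⁺′; ∈-map⁺; ∈-filter⁺; ∈-filter⁻; ∈-allFin)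
open import Data.List.Membership.DecPropositional _≟_ using (_∈?_)
open import Data.List.Relation.Binary.Subset.Propositional using (_⊆_)
open import Data.List.Relation.Unary.Any as Any using (here; there)
open import Data.List.Relation.Unary.All as All using (All; []; _∷_)
open import Data.List.Relation.Unary.All.Properties using (all-filter; ++⁻) renaming (++⁺ to All-++⁺)
open import Data.List.Relation.Unary.AllPairs using ([]; _∷_)
open import Data.List.Relation.Unary.Unique.Propositional using (Unique)
open import Data.List.Relation.Unary.Unique.Propositional.Properties using (allFin⁺) renaming (filter⁺ to Unique-filter⁺)
open import Function.Bundles using (Equivalence; _⇔_; mk⇔)
open import Function.Construct.Composition using (_⇔-∘_)
open import Function.Construct.Symmetry using (⇔-sym)
open import Data.Empty using (⊥-elim)
open import Data.Fin as Fin using (Fin)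
open import Function using (id; _∘_)
open import Level using (0ℓ)
open import Data.Unit using (tt)
open import Data.Product using (_×_; _,_; proj₁; proj₂; ∃; ∃₂)
open import Data.Sum using (_⊎_; inj₁; inj₂; [_,_]′)
import Data.Sum as Sum
open import Relation.Unary using (Pred; Decidable)
open import Relation.Nullary using (¬_; ¬?; yes; no)
open import Relation.Nullary.Decidable using (_⊎-dec_; dec-true; dec-false)
open import Relation.Binary.PropositionalEquality using (_≡_; _≢_; refl; sym; trans; cong; cong₂; subst; module ≡-Reasoning)

OneOf : Letter → Letter → Pred Letter 0ℓ
OneOf x y z = z ≡ x ⊎ z ≡ y

oneOf? : ∀ x y → Decidable (OneOf x y)
oneOf? x y z = (z ≟ x) ⊎-dec (z ≟ y)

restrict-comm : ∀ x y u → restrict x y u ≡ restrict y x u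
restrict-comm x y = filter-≐ (oneOf? x y) (oneOf? y x) (Sum.swap , Sum.swap)

restrict-≡[] : ∀ {x y u} → x ∉ u → y ∉ u → restrict x y u ≡ []
restrict-≡[] {x} {y} x∉u y∉u =
  filter-none (oneOf? x y) (All.tabulate λ z∈u → [ (λ { refl → x∉u z∈u }) , (λ { refl → y∉u z∈u }) ]′)

restrict-≡-filter : ∀ {x y} u → y ∉ u → restrict x y u ≡ filter (_≟ x) u
restrict-≡-filter [] y∉u = refl
restrict-≡-filter {x} {y} (z ∷ u) y∉z∷u with z ≟ x | z ≟ y
... | _       | yes refl = ⊥-elim (y∉z∷u (here refl))
... | yes z≡x | no _     = trans (filter-accept (oneOf? x y) (inj₁ z≡x))
  (trans (cong (z ∷_) (restrict-≡-filter u (y∉z∷u ∘ there))) (sym (filter-accept (_≟ x) z≡x)))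
... | no z≢x  | no z≢y   = trans (filter-reject (oneOf? x y) [ z≢x , z≢y ]′)
  (trans (restrict-≡-filter u (y∉z∷u ∘ there)) (sym (filter-reject (_≟ x) z≢x)))

σ-∷-∈ : ∀ {x u} → x ∈ u → σ (x ∷ u) ≡ σ u
σ-∷-∈ {x} {u} x∈u = cong (if_then σ u else x ∷ σ u) (dec-true (x ∈? u) x∈u)

σ-∷-∉ : ∀ {x u} → x ∉ u → σ (x ∷ u) ≡ x ∷ σ u
σ-∷-∉ {x} {u} x∉u = cong (if_then σ u else x ∷ σ u) (dec-false (x ∈? u) x∉u)

σ-⊆ : ∀ u → σ u ⊆ u
σ-⊆ (x ∷ u) z∈σ with x ∈? u | z∈σ
... | yes _ | z∈σu        = there (σ-⊆ u z∈σu)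
... | no _  | here z≡x    = here z≡x
... | no _  | there z∈σu = there (σ-⊆ u z∈σu)

⊆-σ : ∀ u → u ⊆ σ u
⊆-σ (x ∷ u) z∈x∷u with x ∈? u | z∈x∷u
... | yes x∈u | here refl  = ⊆-σ u x∈u
... | yes _   | there z∈u = ⊆-σ u z∈u
... | no _    | here z≡x   = here z≡x
... | no _    | there z∈u = there (⊆-σ u z∈u)

σ-filter : ∀ {P : Pred Letter 0ℓ} (P? : Decidable P) u → σ (filter P? u) ≡ filter P? (σ u)
σ-filter P? [] = refl
σ-filter P? (x ∷ u) with P? x | x ∈? u
... | no ¬px | yes _ = σ-filter P? u
... | no ¬px | no _  = trans (σ-filter P? u) (sym (filter-reject P? ¬px))
... | yes px | yes x∈u = trans (σ-∷-∈ (∈-filter⁺ P? x∈u px)) (σ-filter P? u)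
... | yes px | no x∉u = trans (σ-∷-∉ (x∉u ∘ proj₁ ∘ ∈-filter⁻ P?))
  (trans (cong (x ∷_) (σ-filter P? u)) (sym (filter-accept P? px)))

σ-++-⊆ : ∀ u v → u ⊆ v → σ (u ++ v) ≡ σ v
σ-++-⊆ []      v u⊆v = refl
σ-++-⊆ (x ∷ u) v u⊆v = trans (σ-∷-∈ (∈-++⁺ʳ u (u⊆v (here refl)))) (σ-++-⊆ u v (u⊆v ∘ there))

σ-pair : ∀ {p q} → p ≢ q → σ (p ∷ q ∷ []) ≡ p ∷ q ∷ []
σ-pair {p} {q} p≢q =
  trans (σ-∷-∉ {u = q ∷ []} λ { (here p≡q) → p≢q p≡q }) (cong (p ∷_) (σ-∷-∉ {u = []} λ ()))

NoAdjRepeat-++⁻ˡ : ∀ u {v} → NoAdjRepeat (u ++ v) → NoAdjRepeat u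
NoAdjRepeat-++⁻ˡ []          _             = tt
NoAdjRepeat-++⁻ˡ (a ∷ [])    _             = tt
NoAdjRepeat-++⁻ˡ (a ∷ b ∷ u) (a≢b , rest) = a≢b , NoAdjRepeat-++⁻ˡ (b ∷ u) rest

NoAdjRepeat-++⁻ʳ : ∀ u {v} → NoAdjRepeat (u ++ v) → NoAdjRepeat v
NoAdjRepeat-++⁻ʳ []          nar      = nar
NoAdjRepeat-++⁻ʳ (a ∷ [])    {[]} _   = tt
NoAdjRepeat-++⁻ʳ (a ∷ [])    {_ ∷ _} (_ , nar) = nar
NoAdjRepeat-++⁻ʳ (a ∷ b ∷ u) (_ , nar) = NoAdjRepeat-++⁻ʳ (b ∷ u) nar

NoAdjRepeat-infix : ∀ u v {w} → NoAdjRepeat (u ++ v ++ w) → NoAdjRepeat v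
NoAdjRepeat-infix u v = NoAdjRepeat-++⁻ˡ v ∘ NoAdjRepeat-++⁻ʳ u

NoAdjRepeat-join : ∀ u q v → NoAdjRepeat (u ++ [ q ]) → NoAdjRepeat (q ∷ v) → NoAdjRepeat (u ++ q ∷ v)
NoAdjRepeat-join []          q v _             nar = nar
NoAdjRepeat-join (a ∷ [])    q v (a≢q , _)    nar = a≢q , nar
NoAdjRepeat-join (a ∷ b ∷ u) q v (a≢b , rest) nar = a≢b , NoAdjRepeat-join (b ∷ u) q v rest nar

Unique⇒NoAdjRepeat : ∀ {r} → Unique r → NoAdjRepeat r
Unique⇒NoAdjRepeat {[]}        _                = tt
Unique⇒NoAdjRepeat {a ∷ []}    _                = tt
Unique⇒NoAdjRepeat {a ∷ b ∷ r} ((a≢b ∷ _) ∷ u) = a≢b , Unique⇒NoAdjRepeat u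

constant⇒¬NoAdjRepeat : ∀ {z r} → All (_≡ z) r → 2 ≤ length r → ¬ NoAdjRepeat r
constant⇒¬NoAdjRepeat (refl ∷ refl ∷ _) (s≤s (s≤s z≤n)) (a≢b , _) = a≢b refl

OneOf-⊆ : ∀ {x y p q} → OneOf x y p → OneOf x y q → p ≢ q → ∀ {z} → OneOf x y z → OneOf p q z
OneOf-⊆ (inj₁ refl) (inj₁ refl) p≢q = ⊥-elim (p≢q refl)
OneOf-⊆ (inj₁ refl) (inj₂ refl) _   = id
OneOf-⊆ (inj₂ refl) (inj₁ refl) _   = Sum.swap
OneOf-⊆ (inj₂ refl) (inj₂ refl) p≢q = ⊥-elim (p≢q refl)

last-two : ∀ {A : Set} (a b : A) l → ∃ λ r₀ → ∃₂ λ p q → a ∷ b ∷ l ≡ r₀ ++ p ∷ q ∷ []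
last-two a b []      = [] , a , b , refl
last-two a b (c ∷ l) with last-two b c l
... | r₀ , p , q , eq = a ∷ r₀ , p , q , cong (a ∷_) eq

σ-ends : ∀ r₀ {p q} → p ≢ q → All (OneOf p q) r₀ → σ (r₀ ++ p ∷ q ∷ []) ≡ p ∷ q ∷ []
σ-ends r₀ p≢q r₀⊆pq = trans (σ-++-⊆ r₀ _ (inPair ∘ All.lookup r₀⊆pq)) (σ-pair p≢q)
  where
  inPair : ∀ {z p q} → OneOf p q z → z ∈ p ∷ q ∷ []
  inPair (inj₁ z≡p) = here z≡p
  inPair (inj₂ z≡q) = there (here z≡q)

NoAdjRepeat-++σ-ends : ∀ r₀ {p q} → All (OneOf p q) r₀ → NoAdjRepeat (r₀ ++ p ∷ q ∷ []) →
                       NoAdjRepeat ((r₀ ++ p ∷ q ∷ []) ++ σ (r₀ ++ p ∷ q ∷ []))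
NoAdjRepeat-++σ-ends r₀ {p} {q} r₀⊆pq nar = subst NoAdjRepeat (sym shape)
  (NoAdjRepeat-join (r₀ ++ [ p ]) q (p ∷ q ∷ [])
    (subst NoAdjRepeat (sym (++-assoc r₀ [ p ] [ q ])) nar) ((p≢q ∘ sym) , p≢q , tt))
  where
  open ≡-Reasoning
  p≢q : p ≢ q
  p≢q = proj₁ (NoAdjRepeat-++⁻ʳ r₀ nar)
  shape : (r₀ ++ p ∷ q ∷ []) ++ σ (r₀ ++ p ∷ q ∷ []) ≡ (r₀ ++ [ p ]) ++ q ∷ p ∷ q ∷ []
  shape = begin
    (r₀ ++ p ∷ q ∷ []) ++ σ (r₀ ++ p ∷ q ∷ []) ≡⟨ cong ((r₀ ++ p ∷ q ∷ []) ++_) (σ-ends r₀ p≢q r₀⊆pq) ⟩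
    (r₀ ++ p ∷ q ∷ []) ++ p ∷ q ∷ []           ≡⟨ ++-assoc r₀ (p ∷ q ∷ []) (p ∷ q ∷ []) ⟩
    r₀ ++ p ∷ q ∷ p ∷ q ∷ []                   ≡⟨ ++-assoc r₀ [ p ] (q ∷ p ∷ q ∷ []) ⟨
    (r₀ ++ [ p ]) ++ q ∷ p ∷ q ∷ []            ∎

NoAdjRepeat-++σ : ∀ {x y} r → x ≢ y → All (OneOf x y) r → x ∈ r → y ∈ r →
                  NoAdjRepeat r → NoAdjRepeat (r ++ σ r)
NoAdjRepeat-++σ (_ ∷ [])    x≢y _ (here refl) (here refl) _ = ⊥-elim (x≢y refl)
NoAdjRepeat-++σ (a ∷ b ∷ l) _ r⊆xy _ _ nar with last-two a b l
... | r₀ , p , q , eq = subst (λ r → NoAdjRepeat (r ++ σ r)) (sym eq) (NoAdjRepeat-++σ-ends r₀ r₀⊆pq nar′)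
  where
  nar′ : NoAdjRepeat (r₀ ++ p ∷ q ∷ [])
  nar′ = subst NoAdjRepeat eq nar
  r₀⊆pq : All (OneOf p q) r₀
  r₀⊆pq with r₀⊆xy , p∈xy ∷ q∈xy ∷ [] ← ++⁻ r₀ (subst (All _) eq r⊆xy) =
    All.map (OneOf-⊆ p∈xy q∈xy (proj₁ (NoAdjRepeat-++⁻ʳ r₀ nar′))) r₀⊆xy

module _ {A : Set} where

  nest : (A → Word) → Word → (A → Word) → List A → Word
  nest F S H []      = S
  nest F S H (i ∷ L) = F i ++ nest F S H L ++ H i

  concat-map-reverse : ∀ (H : A → Word) i L → concat (map H (reverse (i ∷ L))) ≡ concat (map H (reverse L)) ++ H i
  concat-map-reverse H i L = begin
    concat (map H (reverse (i ∷ L)))          ≡⟨ cong (concat ∘ map H) (unfold-reverse i L) ⟩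
    concat (map H (reverse L ++ [ i ]))        ≡⟨ cong concat (map-++ H (reverse L) [ i ]) ⟩
    concat (map H (reverse L) ++ [ H i ])      ≡⟨ concat-++ (map H (reverse L)) [ H i ] ⟨
    concat (map H (reverse L)) ++ H i ++ []   ≡⟨ cong (concat (map H (reverse L)) ++_) (++-identityʳ (H i)) ⟩
    concat (map H (reverse L)) ++ H i         ∎
    where open ≡-Reasoning

  concat-map-++-reverse : ∀ F S H L → concat (map F L) ++ S ++ concat (map H (reverse L)) ≡ nest F S H L
  concat-map-++-reverse F S H []      = ++-identityʳ S
  concat-map-++-reverse F S H (i ∷ L) = begin
    (F i ++ C) ++ S ++ concat (map H (reverse (i ∷ L))) ≡⟨ cong (λ t → (F i ++ C) ++ S ++ t) (concat-map-reverse H i L) ⟩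
    (F i ++ C) ++ S ++ R ++ H i                          ≡⟨ ++-assoc (F i) C (S ++ R ++ H i) ⟩
    F i ++ C ++ S ++ R ++ H i                            ≡⟨ cong (λ t → F i ++ C ++ t) (++-assoc S R (H i)) ⟨
    F i ++ C ++ (S ++ R) ++ H i                          ≡⟨ cong (F i ++_) (++-assoc C (S ++ R) (H i)) ⟨
    F i ++ (C ++ S ++ R) ++ H i                          ≡⟨ cong (λ t → F i ++ t ++ H i) (concat-map-++-reverse F S H L) ⟩
    F i ++ nest F S H L ++ H i                           ∎
    where
    open ≡-Reasoning
    C = concat (map F L)
    R = concat (map H (reverse L))

  filter-nest : ∀ {P : Pred Letter 0ℓ} (P? : Decidable P) F S H L →
                filter P? (nest F S H L) ≡ nest (filter P? ∘ F) (filter P? S) (filter P? ∘ H) L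
  filter-nest P? F S H []      = refl
  filter-nest P? F S H (i ∷ L) = begin
    filter P? (F i ++ nest F S H L ++ H i)                  ≡⟨ filter-++ P? (F i) _ ⟩
    filter P? (F i) ++ filter P? (nest F S H L ++ H i)      ≡⟨ cong (filter P? (F i) ++_) (filter-++ P? (nest F S H L) (H i)) ⟩
    filter P? (F i) ++ filter P? (nest F S H L) ++ filter P? (H i)
      ≡⟨ cong (λ t → filter P? (F i) ++ t ++ filter P? (H i)) (filter-nest P? F S H L) ⟩
    filter P? (F i) ++ nest (filter P? ∘ F) (filter P? S) (filter P? ∘ H) L ++ filter P? (H i) ∎
    where open ≡-Reasoning

  module _ (F H : A → Word) where

    Vacant : A → Set
    Vacant i = F i ≡ [] × H i ≡ []

    nest-skip : ∀ {S i L} → Vacant i → nest F S H (i ∷ L) ≡ nest F S H L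
    nest-skip (Fi≡[] , Hi≡[]) rewrite Fi≡[] | Hi≡[] = ++-identityʳ _

    nest-vacant : ∀ {S L} → All Vacant L → nest F S H L ≡ S
    nest-vacant []       = refl
    nest-vacant {S} {i ∷ L} (v ∷ vs) = trans (nest-skip {S} {i} {L} v) (nest-vacant vs)

    nest-single : ∀ {S a L} → Unique L → a ∈ L → All (λ i → i ≢ a → Vacant i) L →
                  nest F S H L ≡ F a ++ S ++ H a
    nest-single (a∉L ∷ _) (here refl) (_ ∷ vs) =
      cong (λ t → F _ ++ t ++ H _) (nest-vacant (All.zipWith (λ (a≢i , v) → v (a≢i ∘ sym)) (a∉L , vs)))
    nest-single {S} {L = i ∷ L} (i∉L ∷ u) (there a∈L) (v ∷ vs) =
      trans (nest-skip {S} {i} {L} (v (All.lookup i∉L a∈L))) (nest-single u a∈L vs)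

    NoAdjRepeat-nest⁻ : ∀ {S a L} → a ∈ L → NoAdjRepeat (nest F S H L) → NoAdjRepeat (F a)
    NoAdjRepeat-nest⁻ {a = a} (here refl) = NoAdjRepeat-++⁻ˡ (F a)
    NoAdjRepeat-nest⁻ {S} {L = i ∷ L} (there a∈L) =
      NoAdjRepeat-nest⁻ a∈L ∘ NoAdjRepeat-infix (F i) (nest F S H L)

    -- With an empty middle, the innermost non-vacant index i contributes the factor F i ++ H i.
    nest-turn : (∀ i → Vacant i ⊎ ¬ NoAdjRepeat (F i ++ H i)) →
                ∀ L → NoAdjRepeat (nest F [] H L) → All Vacant L
    nest-turn dich []      _   = []
    nest-turn dich (i ∷ L) nar with nest-turn dich L (NoAdjRepeat-infix (F i) (nest F [] H L) nar) | dich i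
    ... | vs | inj₁ v   = v ∷ vs
    ... | vs | inj₂ bad = ⊥-elim (bad (subst (λ t → NoAdjRepeat (F i ++ t ++ H i)) (nest-vacant vs) nar))

  All-nest⁺ : ∀ {P : Pred Letter 0ℓ} {F S H} → (∀ i → All P (F i)) → All P S → (∀ i → All P (H i)) →
              ∀ L → All P (nest F S H L)
  All-nest⁺ PF PS PH []      = PS
  All-nest⁺ PF PS PH (i ∷ L) = All-++⁺ (PF i) (All-++⁺ (All-nest⁺ PF PS PH L) (PH i))

count-∷-self : ∀ a u → length (filter (_≟ a) (a ∷ u)) ≡ suc (length (filter (_≟ a) u))
count-∷-self a u = cong length (filter-accept (_≟ a) refl)

count-∷-other : ∀ {x} a u → a ≢ x → length (filter (_≟ x) (a ∷ u)) ≡ length (filter (_≟ x) u)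
count-∷-other {x} a u a≢x = cong length (filter-reject (_≟ x) a≢x)

count-∈ : ∀ {x u} → x ∈ u → 1 ≤ length (filter (_≟ x) u)
count-∈ {x} x∈u = filter-some (_≟ x) (Any.map sym x∈u)

Uniform-1⇒Unique : ∀ w → Uniform 1 w → Unique w
Uniform-1⇒Unique []      _    = []
Uniform-1⇒Unique (a ∷ u) unif = All.tabulate (λ z∈u a≡z → a∉u (subst (_∈ u) (sym a≡z) z∈u))
                             ∷ Uniform-1⇒Unique u unif-u
  where
  a∉u : a ∉ u
  a∉u a∈u with () ← subst (1 ≤_) (suc-injective (trans (sym (count-∷-self a u)) (unif a (here refl)))) (count-∈ a∈u)
  unif-u : Uniform 1 u
  unif-u x x∈u = trans (sym (count-∷-other a u (λ { refl → a∉u x∈u }))) (unif x (there x∈u))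

Uniform-1⇒Complete : ∀ {w G} → Represents w G → Uniform 1 w → Complete G
Uniform-1⇒Complete {w} (_ , alt⇔adj) unif x y x∈V y∈V x≢y =
  Equivalence.to (alt⇔adj x y x∈V y∈V x≢y)
    (Unique⇒NoAdjRepeat (Unique-filter⁺ (oneOf? x y) (Uniform-1⇒Unique w unif)))

Uniform-¬Complete⇒≥2 : ∀ {w G k x} → Represents w G → ¬ Complete G → Uniform k w → x ∈ w → 2 ≤ k
Uniform-¬Complete⇒≥2         {k = 0}           _   _     unif x∈w with () ← subst (1 ≤_) (unif _ x∈w) (count-∈ x∈w)
Uniform-¬Complete⇒≥2 {w} {G} {k = 1}           rep ¬comp unif _   = ⊥-elim (¬comp (Uniform-1⇒Complete {w} {G} rep unif))
Uniform-¬Complete⇒≥2         {k = suc (suc _)} _   _     _    _   = s≤s (s≤s z≤n)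

concat-map-filter : ∀ {A : Set} {P : Pred A 0ℓ} (P? : Decidable P) {f g : A → Word} →
                    (∀ i → P i → g i ≡ f i) → (∀ i → ¬ P i → g i ≡ []) →
                    ∀ L → concat (map f (filter P? L)) ≡ concat (map g L)
concat-map-filter P?           g≡f g≡[] []      = refl
concat-map-filter P? {g = g} g≡f g≡[] (i ∷ L) with P? i
... | yes Pi = cong₂ _++_ (sym (g≡f i Pi)) (concat-map-filter P? g≡f g≡[] L)
... | no ¬Pi = trans (concat-map-filter P? g≡f g≡[] L) (cong (_++ concat (map g L)) (sym (g≡[] i ¬Pi)))

module Glue (G : Graph) (n : ℕ) (Gs : Fin n → Graph) (comp : ComponentsOf G n Gs)
            (ws : Fin n → Word) (rep : ∀ i → Represents (ws i) (Gs i)) (j : Fin n)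
            (twice : ∀ {p} → p ∈ ws j → 2 ≤ length (filter (_≟ p) (ws j))) where

  -- The block of component i in the second half; σ (ws j) sits in the middle instead.
  mirror : Fin n → Word
  mirror i with i Fin.≟ j
  ... | yes _ = []
  ... | no _  = σ (ws i)

  mirror-⊆ : ∀ i → mirror i ⊆ ws i
  mirror-⊆ i with i Fin.≟ j
  ... | no _ = σ-⊆ (ws i)

  mirror-≢ : ∀ i → i ≢ j → mirror i ≡ σ (ws i)
  mirror-≢ i i≢j with i Fin.≟ j
  ... | yes i≡j = ⊥-elim (i≢j i≡j)
  ... | no _    = refl

  glue≡nest : glue n ws j ≡ nest ws (σ (ws j)) mirror (allFin n)
  glue≡nest = trans
    (cong (λ t → concat (map ws (allFin n)) ++ σ (ws j) ++ t)
      (concat-map-filter (λ i → ¬? (i Fin.≟ j)) mirror-≢ mirror-≡ (reverse (allFin n))))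
    (concat-map-++-reverse ws (σ (ws j)) mirror (allFin n))
    where
    mirror-≡ : ∀ i → ¬ i ≢ j → mirror i ≡ []
    mirror-≡ i ¬i≢j with i Fin.≟ j
    ... | yes _   = refl
    ... | no i≢j = ⊥-elim (¬i≢j i≢j)

  L : List (Fin n)
  L = allFin n

  ws⊆V : ∀ {i z} → z ∈ ws i → z ∈ V (Gs i)
  ws⊆V {i} {z} = Equivalence.to (proj₁ (rep i) z)

  V⊆ws : ∀ {i z} → z ∈ V (Gs i) → z ∈ ws i
  V⊆ws {i} {z} = Equivalence.from (proj₁ (rep i) z)

  component-of : ∀ {z} → z ∈ V G → ∃ λ a → z ∈ V (Gs a)
  component-of {z} = Equivalence.to (proj₁ (proj₂ comp) z)

  component⊆V : ∀ {a z} → z ∈ V (Gs a) → z ∈ V G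
  component⊆V {a} {z} z∈Va = Equivalence.from (proj₁ (proj₂ comp) z) (a , z∈Va)

  component-unique : ∀ {a b z} → z ∈ V (Gs a) → z ∈ V (Gs b) → a ≡ b
  component-unique = proj₁ (proj₂ (proj₂ comp)) _ _ _

  adjacent-in-component : ∀ {a x y} → x ∈ V (Gs a) → y ∈ V (Gs a) → Adj G x y ⇔ Adj (Gs a) x y
  adjacent-in-component = proj₁ (proj₂ (proj₂ (proj₂ comp))) _ _ _

  edge-in-component : ∀ {x y} → Adj G x y → ∃ λ a → x ∈ V (Gs a) × y ∈ V (Gs a)
  edge-in-component = proj₂ (proj₂ (proj₂ (proj₂ comp))) _ _

  foreign : ∀ {a i z u} → z ∈ V (Gs a) → i ≢ a → u ⊆ ws i → z ∉ u
  foreign z∈Va i≢a u⊆ws z∈u = i≢a (component-unique (ws⊆V (u⊆ws z∈u)) z∈Va)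

  module _ {x y : Letter} where

    R : Word → Word
    R = restrict x y

    restrict-glue : R (glue n ws j) ≡ nest (R ∘ ws) (R (σ (ws j))) (R ∘ mirror) L
    restrict-glue = trans (cong R glue≡nest) (filter-nest (oneOf? x y) ws (σ (ws j)) mirror L)

    restrict-outside : ∀ {a b i u} → x ∈ V (Gs a) → y ∈ V (Gs b) → i ≢ a → i ≢ b → u ⊆ ws i → R u ≡ []
    restrict-outside x∈Va y∈Vb i≢a i≢b u⊆ws = restrict-≡[] (foreign x∈Va i≢a u⊆ws) (foreign y∈Vb i≢b u⊆ws)

    vacant-outside : ∀ {a b i} → x ∈ V (Gs a) → y ∈ V (Gs b) → i ≢ a → i ≢ b → Vacant (R ∘ ws) (R ∘ mirror) i
    vacant-outside {i = i} x∈Va y∈Vb i≢a i≢b =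
      restrict-outside x∈Va y∈Vb i≢a i≢b id , restrict-outside x∈Va y∈Vb i≢a i≢b (mirror-⊆ i)

    middle-++-mirror : ∀ {a} → x ∈ V (Gs a) → y ∈ V (Gs a) → R (σ (ws j)) ++ R (mirror a) ≡ σ (R (ws a))
    middle-++-mirror {a} x∈Va y∈Va with a Fin.≟ j
    ... | yes refl = trans (++-identityʳ _) (sym (σ-filter (oneOf? x y) (ws j)))
    ... | no a≢j   = trans (cong (_++ _) (restrict-outside x∈Va y∈Va (a≢j ∘ sym) (a≢j ∘ sym) (σ-⊆ (ws j))))
                           (sym (σ-filter (oneOf? x y) (ws a)))

    restrict-glue-same : ∀ {a} → x ∈ V (Gs a) → y ∈ V (Gs a) → R (glue n ws j) ≡ R (ws a) ++ σ (R (ws a))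
    restrict-glue-same {a} x∈Va y∈Va = begin
      R (glue n ws j)                              ≡⟨ restrict-glue ⟩
      nest (R ∘ ws) (R (σ (ws j))) (R ∘ mirror) L  ≡⟨ nest-single (R ∘ ws) (R ∘ mirror) (allFin⁺ n) (∈-allFin a) outside ⟩
      R (ws a) ++ R (σ (ws j)) ++ R (mirror a)     ≡⟨ cong (R (ws a) ++_) (middle-++-mirror x∈Va y∈Va) ⟩
      R (ws a) ++ σ (R (ws a))                     ∎
      where
      open ≡-Reasoning
      outside : All (λ i → i ≢ a → Vacant (R ∘ ws) (R ∘ mirror) i) L
      outside = All.tabulate λ _ i≢a → vacant-outside x∈Va y∈Va i≢a i≢a

    alternate-same : ∀ {a} → x ∈ V (Gs a) → y ∈ V (Gs a) → x ≢ y → Alternate x y (glue n ws j) ⇔ Alternate x y (ws a)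
    alternate-same {a} x∈Va y∈Va x≢y rewrite restrict-glue-same x∈Va y∈Va = mk⇔
      (NoAdjRepeat-++⁻ˡ (R (ws a)))
      (NoAdjRepeat-++σ (R (ws a)) x≢y (all-filter (oneOf? x y) (ws a))
        (∈-filter⁺ (oneOf? x y) (V⊆ws x∈Va) (inj₁ refl)) (∈-filter⁺ (oneOf? x y) (V⊆ws y∈Va) (inj₂ refl)))

    Monochrome : Fin n → Letter → Set
    Monochrome c z = z ∈ V (Gs c) × (∀ {u} → u ⊆ ws c → R u ≡ filter (_≟ z) u)

    first-half-repeats : ∀ {z} → Monochrome j z → ¬ NoAdjRepeat (R (ws j))
    first-half-repeats {z} (z∈Vj , mono) rewrite mono {ws j} id =
      constant⇒¬NoAdjRepeat (all-filter (_≟ z) (ws j)) (twice (V⊆ws z∈Vj))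

    turn-repeats : ∀ {c z} → c ≢ j → Monochrome c z → ¬ NoAdjRepeat (R (ws c) ++ R (mirror c))
    turn-repeats {c} {z} c≢j (z∈Vc , mono) rewrite mono {ws c} id | mono (mirror-⊆ c) =
      constant⇒¬NoAdjRepeat (All-++⁺ (all-filter (_≟ z) (ws c)) (all-filter (_≟ z) (mirror c)))
        (subst (2 ≤_) (sym (length-++ (filter (_≟ z) (ws c))))
          (+-mono-≤ (count-∈ (V⊆ws z∈Vc))
                    (count-∈ (subst (z ∈_) (sym (mirror-≢ c c≢j)) (⊆-σ (ws c) (V⊆ws z∈Vc))))))

    module _ {a b} (x∈Va : x ∈ V (Gs a)) (y∈Vb : y ∈ V (Gs b)) (a≢b : a ≢ b) where

      monochrome-a : Monochrome a x
      monochrome-a = x∈Va , λ u⊆ws → restrict-≡-filter _ (foreign y∈Vb a≢b u⊆ws)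

      monochrome-b : Monochrome b y
      monochrome-b = y∈Vb , λ {u} u⊆ws →
        trans (restrict-comm x y u) (restrict-≡-filter u (foreign x∈Va (a≢b ∘ sym) u⊆ws))

      vacant-or-turn-repeats : a ≢ j → b ≢ j → ∀ i →
        Vacant (R ∘ ws) (R ∘ mirror) i ⊎ ¬ NoAdjRepeat (R (ws i) ++ R (mirror i))
      vacant-or-turn-repeats a≢j b≢j i with i Fin.≟ a | i Fin.≟ b
      ... | yes refl | _        = inj₂ (turn-repeats a≢j monochrome-a)
      ... | no _     | yes refl = inj₂ (turn-repeats b≢j monochrome-b)
      ... | no i≢a   | no i≢b   = inj₁ (vacant-outside x∈Va y∈Vb i≢a i≢b)

      ¬NoAdjRepeat-nest : ¬ NoAdjRepeat (nest (R ∘ ws) (R (σ (ws j))) (R ∘ mirror) L)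
      ¬NoAdjRepeat-nest nar with a Fin.≟ j | b Fin.≟ j
      ... | yes refl | _        = first-half-repeats monochrome-a (NoAdjRepeat-nest⁻ (R ∘ ws) (R ∘ mirror) (∈-allFin j) nar)
      ... | no _     | yes refl = first-half-repeats monochrome-b (NoAdjRepeat-nest⁻ (R ∘ ws) (R ∘ mirror) (∈-allFin j) nar)
      ... | no a≢j   | no b≢j   = ∉[] (subst (x ∈_) Ra≡[] (∈-filter⁺ (oneOf? x y) (V⊆ws x∈Va) (inj₁ refl)))
        where
        middle≡[] : R (σ (ws j)) ≡ []
        middle≡[] = restrict-outside x∈Va y∈Vb (a≢j ∘ sym) (b≢j ∘ sym) (σ-⊆ (ws j))
        Ra≡[] : R (ws a) ≡ []
        Ra≡[] = proj₁ (All.lookup (nest-turn (R ∘ ws) (R ∘ mirror) (vacant-or-turn-repeats a≢j b≢j) L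
                  (subst (λ S → NoAdjRepeat (nest (R ∘ ws) S (R ∘ mirror) L)) middle≡[] nar)) (∈-allFin a))

      ¬alternate-across : ¬ Alternate x y (glue n ws j)
      ¬alternate-across = ¬NoAdjRepeat-nest ∘ subst NoAdjRepeat restrict-glue

  glue⊆V : ∀ {z} → z ∈ glue n ws j → z ∈ V G
  glue⊆V = All.lookup (subst (All (_∈ V G)) (sym glue≡nest)
    (All-nest⁺ (λ i → in-V id) (in-V (σ-⊆ (ws j))) (λ i → in-V (mirror-⊆ i)) L))
    where
    in-V : ∀ {i u} → u ⊆ ws i → All (_∈ V G) u
    in-V u⊆ws = All.tabulate (component⊆V ∘ ws⊆V ∘ u⊆ws)

  V⊆glue : ∀ {z} → z ∈ V G → z ∈ glue n ws j
  V⊆glue z∈V with a , z∈Va ← component-of z∈V = ∈-++⁺ˡ (∈-concat⁺′ (V⊆ws z∈Va) (∈-map⁺ ws (∈-allFin a)))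

  alternate⇔adjacent : ∀ x y → x ∈ V G → y ∈ V G → x ≢ y → Alternate x y (glue n ws j) ⇔ Adj G x y
  alternate⇔adjacent x y x∈V y∈V x≢y with a , x∈Va ← component-of x∈V | b , y∈Vb ← component-of y∈V | a Fin.≟ b
  ... | yes refl =
    ⇔-sym (adjacent-in-component x∈Va y∈Vb) ⇔-∘ (proj₂ (rep a) x y x∈Va y∈Vb x≢y ⇔-∘ alternate-same x∈Va y∈Vb x≢y)
  ... | no a≢b   = mk⇔ (⊥-elim ∘ ¬alternate-across x∈Va y∈Vb a≢b) (⊥-elim ∘ a≢b ∘ same-component)
    where
    same-component : Adj G x y → a ≡ b
    same-component adj with i , x∈Vi , y∈Vi ← edge-in-component adj =
      trans (component-unique x∈Va x∈Vi) (component-unique y∈Vi y∈Vb)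

  represents : Represents (glue n ws j) G
  represents = (λ z → mk⇔ glue⊆V V⊆glue) , alternate⇔adjacent

mainTheorem7 : (G : Graph) (n : ℕ) (Gs : Fin n → Graph) →
    n ≥ 2 → ComponentsOf G n Gs →
    (ws : Fin n → Word) →
    (∀ i → SquareFree (ws i)) → (∀ i → Represents (ws i) (Gs i)) →
    (j : Fin n) → ¬ Complete (Gs j) →
    (k : ℕ) → RepNumber (Gs j) k → Uniform k (ws j) →
    Represents (glue n ws j) G
mainTheorem7 G n Gs _ comp ws _ rep j ¬complete k _ uniform = Glue.represents G n Gs comp ws rep j twice
  where
  twice : ∀ {p} → p ∈ ws j → 2 ≤ length (filter (_≟ p) (ws j))
  twice p∈w = subst (2 ≤_) (sym (uniform _ p∈w)) (Uniform-¬Complete⇒≥2 {ws j} {Gs j} (rep j) ¬complete uniform p∈w)
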